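{- For $n\ge 81$, there is a deterministic algorithm ($1$-Cover) which, given $n$ elements, makes at most $3n^{3/2}$ comparisons and finds a $1$-max-set of size at most $\sqrt n$.
   Context: Model: each element $x_i$ has an unknown real value $\mathrm{val}(x_i)$. A comparator query on $x_i,x_j$ returns "$x_i\ge x_j$" or "$x_j\ge x_i$"; the answer is correct if $|\mathrm{val}(x_i)-\mathrm{val}(x_j)|>1$ and arbitrary (possibly adversarial) otherwise. Let $x^*$ denote an element of maximum value. A $k$-max-set is a subset of the elements containing at least one element of value at least $\mathrm{val}(x^*)-k$; the output must be such a set for every input and every consistent comparator behavior.
   Formalization: The unknown element values $\mathrm{val}(x_i)$ are rational numbers rather than real numbers. -}

module Defs where

open import Data.Nat using (ℕ; zero; suc; _*_; _^_) renaming (_≤_ to _≤ℕ_)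
open import Data.Fin using (Fin)
open import Data.Bool using (Bool; true; false)
open import Data.List using (List; length)
open import Data.List.Membership.Propositional using (_∈_)
open import Data.Product using (_×_; Σ-syntax)
open import Data.Rational using (ℚ; _+_; _≤_; 1ℚ)

-- A deterministic comparison-based algorithm on n elements, as a (finite)
-- adaptive decision tree: either stop and output a list of elements, or
-- query the comparator on (i , j) and continue depending on the answer.
-- Answer true  means the comparator said  "x_i ≥ x_j";
-- answer false means the comparator said  "x_j ≥ x_i".
data Alg (n : ℕ) : Set where
  done  : List (Fin n) → Alg n
  query : Fin n → Fin n → (Bool → Alg n) → Alg n

-- An answer is admissible for the imprecise comparator with values val:
-- it must be correct whenever |val i - val j| > 1, arbitrary otherwise.
Admissible : {n : ℕ} → (Fin n → ℚ) → Fin n → Fin n → Bool → Set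
Admissible val i j true  = val j ≤ val i + 1ℚ
Admissible val i j false = val i ≤ val j + 1ℚ

IsKMaxSet : {n : ℕ} → (Fin n → ℚ) → ℚ → List (Fin n) → Set
IsKMaxSet {n} val k S = Σ[ y ∈ Fin n ] (y ∈ S × ((x : Fin n) → val x ≤ val y + k))

-- Good val budget sizeBound c A : on every run of A against an adversarial
-- comparator consistent with val (having already used c comparisons), the
-- total number of comparisons satisfies `budget`, the output satisfies
-- `sizeBound` on its length, and the output is a 1-max-set.
Good : {n : ℕ} → (Fin n → ℚ) → (ℕ → Set) → (ℕ → Set) → ℕ → Alg n → Set
Good val budget sizeBound c (done S) =
  budget c × sizeBound (length S) × IsKMaxSet val 1ℚ S
Good val budget sizeBound c (query i j next) =
  (b : Bool) → Admissible val i j b → Good val budget sizeBound (suc c) (next b)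

-- c ≤ 3 n^{3/2}  ⇔  c² ≤ 9 n³   (c ∈ ℕ)
WithinComparisons : ℕ → ℕ → Set
WithinComparisons n c = c * c ≤ℕ 9 * n ^ 3

-- s ≤ √n  ⇔  s² ≤ n   (s ∈ ℕ)
WithinSqrt : ℕ → ℕ → Set
WithinSqrt n s = s * s ≤ℕ n

-- Run 1-Cover with s = ⌊√n⌋ rounds and groups of g + 1 = 3s + 1 elements. In a round the first
-- g + 1 undecided elements play a round-robin tournament. Every element beaten by the player with
-- the most wins is within 1 of it, so it is settled, and the champion goes into the output. The
-- champion beats at least half of its group, so the q(q+1)/2 comparisons of a round cost at most g
-- per settled element, which gives at most g·n ≤ 3n^{3/2} in total. Every element ends up within 1
-- of some output element, so the best output element is within 1 of the maximum. Full rounds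
-- settle at least ⌈g/2⌉ + 1 elements each, and once at most g + 1 are left every round halves
-- them. This gives at most s rounds when s ≥ 18; the cases 9 ≤ s < 18 are checked by evaluation.
module Submission where

open import Data.Bool using (Bool; true; false; not; if_then_else_)
open import Data.Fin using (Fin; zero; suc; toℕ; fromℕ<)
open import Data.Fin.Properties using (all?; toℕ-fromℕ<)
open import Data.List using (List; []; _∷_; allFin; length; lookup; take; drop; _++_)
import Data.List.Extrema
open import Data.List.Extrema.Nat using (argmax; f[xs]≤f[argmax])
open import Data.List.Membership.Propositional using (_∈_)
open import Data.List.Membership.Propositional.Properties using (∈-allFin; ∈-++⁻; ∈-++⁺ˡ; ∈-++⁺ʳ)
open import Data.List.Properties using (length-tabulate; length-++; length-take; length-drop; take++drop≡id)
import Data.List.Relation.Unary.All as All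
open import Data.List.Relation.Unary.Any using (here; there; index)
open import Data.List.Relation.Unary.Any.Properties using (lookup-index)
open import Data.Nat
open import Data.Nat.DivMod using (_/_; _%_; m/n*n≤m; m≡m%n+[m/n]*n; m%n<n; /-monoˡ-≤)
open import Data.Nat.GeneralisedArithmetic using (iterate)
open import Data.Nat.Properties
open import Data.Nat.Solver using (module +-*-Solver)
open import Data.Product using (Σ; _×_; _,_; ∃-syntax)
open import Data.Rational using (ℚ; 1ℚ) renaming (_+_ to _+ℚ_; _≤_ to _≤ℚ_)
import Data.Rational.Properties as ℚ
open import Data.Sum using (_⊎_; inj₁; inj₂; [_,_]′)
import Data.Vec.Functional as Vector
open import Function using (_∘_; id)
open import Relation.Binary.Bundles using (DecTotalOrder)
open import Relation.Binary.Definitions using (Total)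
open import Relation.Binary.PropositionalEquality
open import Relation.Nullary using (Dec; yes; no)
open import Relation.Nullary.Decidable using (from-yes)

open import Defs
open import Algebra.Properties.CommutativeMonoid.Sum +-0-commutativeMonoid using (sum; ∑-distrib-+)
open +-*-Solver

private variable
  A : Set
  p q n g : ℕ

-- T i j ≡ true records that the comparator declared player i ≥ player j.
Table : ℕ → Set
Table p = Fin p → Fin p → Bool

Wins : Table p → Fin p → Fin p → Set
Wins T i j = T i j ≡ true

count : (Fin p → Bool) → ℕ
count b = sum (λ i → if b i then 1 else 0)

count-cover : (b c : Fin p → Bool) → (∀ i → b i ≡ true ⊎ c i ≡ true) → p ≤ count b + count c
count-cover {zero}  b c b∨c = z≤n
count-cover {suc p} b c b∨c
  with b zero | c zero | b∨c zero | count-cover (b ∘ suc) (c ∘ suc) (b∨c ∘ suc)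
... | true  | y     | _        | ih =
  s≤s (≤-trans ih (+-monoʳ-≤ (count (b ∘ suc)) (m≤n+m (count (c ∘ suc)) (if y then 1 else 0))))
... | false | true  | _        | ih = ≤-trans (s≤s ih) (≤-reflexive (sym (+-suc _ _)))
... | false | false | inj₁ () | _
... | false | false | inj₂ () | _

count-not : (b : Fin p → Bool) → count (not ∘ b) + count b ≡ p
count-not {zero}  b = refl
count-not {suc p} b with b zero | count-not (b ∘ suc)
... | true  | ih = trans (+-suc _ _) (cong suc ih)
... | false | ih = cong suc ih

sum-≤ : (f : Fin p → ℕ) {m : ℕ} → (∀ i → f i ≤ m) → sum f ≤ p * m
sum-≤ {zero}  f f≤m = z≤n
sum-≤ {suc p} f f≤m = +-mono-≤ (f≤m zero) (sum-≤ (f ∘ suc) (f≤m ∘ suc))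

sum-wins : (T : Table p) → Total (Wins T) → p * suc p ≤ 2 * sum (λ i → count (T i))
sum-wins {zero}  T total = z≤n
sum-wins {suc p} T total with T zero zero | total zero zero
... | false | inj₁ ()
... | false | inj₂ ()
... | true  | _ = begin
  suc p * suc (suc p)
    ≡⟨ solve 1 (λ x → (con 1 :+ x) :* (con 2 :+ x) := con 2 :* (con 1 :+ x) :+ x :* (con 1 :+ x)) refl p ⟩
  2 * suc p + p * suc p
    ≤⟨ +-mono-≤ (*-monoʳ-≤ 2 (s≤s row-and-column)) (sum-wins T′ (λ i j → total (suc i) (suc j))) ⟩
  2 * suc (a + b) + 2 * s
    ≡⟨ solve 3 (λ a b c → con 2 :* (con 1 :+ (a :+ b)) :+ con 2 :* c := con 2 :* ((con 1 :+ a) :+ (b :+ c)))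
         refl a b s ⟩
  2 * (suc a + (b + s))
    ≡⟨ cong (λ x → 2 * (suc a + x)) (sym (∑-distrib-+ column (λ i → count (T′ i)))) ⟩
  2 * (suc a + sum (λ i → column i + count (T′ i)))  ∎
  where
  open ≤-Reasoning
  T′ : Table p
  T′ i j = T (suc i) (suc j)
  column : Fin p → ℕ
  column i = if T (suc i) zero then 1 else 0
  a = count (T zero ∘ suc)
  b = count (λ i → T (suc i) zero)
  s = sum (λ i → count (T′ i))
  row-and-column : p ≤ a + b
  row-and-column = count-cover (T zero ∘ suc) (λ i → T (suc i) zero) (total zero ∘ suc)

-- Opaque because evaluating the argmax of a table of unknown size makes type checking blow up.
opaque
  champion : Table (suc p) → Fin (suc p)
  champion T = argmax (λ i → count (T i)) zero (allFin _)

  count-≤-champion : (T : Table (suc p)) (i : Fin (suc p)) → count (T i) ≤ count (T (champion T))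
  count-≤-champion T i =
    All.lookup (f[xs]≤f[argmax] {f = λ i → count (T i)} zero (allFin _)) (∈-allFin i)

champion-wins : (T : Table (suc p)) → Total (Wins T) → 2 + p ≤ 2 * count (T (champion T))
champion-wins {p} T total = *-cancelˡ-≤ (suc p) (begin
  suc p * (2 + p)                 ≤⟨ sum-wins T total ⟩
  2 * sum (λ i → count (T i))     ≤⟨ *-monoʳ-≤ 2 (sum-≤ (λ i → count (T i)) (count-≤-champion T)) ⟩
  2 * (suc p * w)                 ≡⟨ solve 2 (λ x y → con 2 :* (x :* y) := x :* (con 2 :* y)) refl (suc p) w ⟩
  suc p * (2 * w)                 ∎)
  where
  open ≤-Reasoning
  w = count (T (champion T))

unbeaten-by-champion : (T : Table (suc p)) → Total (Wins T) → count (not ∘ T (champion T)) ≤ ⌊ p /2⌋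
unbeaten-by-champion {p} T total = begin
  r                ≡⟨ n≡⌊n+n/2⌋ r ⟩
  ⌊ r + r /2⌋      ≤⟨ ⌊n/2⌋-mono (+-cancelʳ-≤ (2 + p) (r + r) p twice-unbeaten) ⟩
  ⌊ p /2⌋          ∎
  where
  open ≤-Reasoning
  w = count (T (champion T))
  r = count (not ∘ T (champion T))
  twice-unbeaten : (r + r) + (2 + p) ≤ p + (2 + p)
  twice-unbeaten = begin
    (r + r) + (2 + p)    ≤⟨ +-monoʳ-≤ (r + r) (champion-wins T total) ⟩
    (r + r) + 2 * w      ≡⟨ solve 2 (λ a b → (a :+ a) :+ con 2 :* b := (a :+ b) :+ (a :+ b)) refl r w ⟩
    (r + w) + (r + w)    ≡⟨ cong₂ _+_ (count-not (T (champion T))) (count-not (T (champion T))) ⟩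
    suc p + suc p        ≡⟨ solve 1 (λ a → (con 1 :+ a) :+ (con 1 :+ a) := a :+ (con 2 :+ a)) refl p ⟩
    p + (2 + p)          ∎

compareWith : Fin n → (Fin q → Fin n) → ((Fin q → Bool) → Alg n) → Alg n
compareWith {q = zero}  x h k = k Vector.[]
compareWith {q = suc q} x h k = query x (h zero) λ b → compareWith x (h ∘ suc) (k ∘ (b Vector.∷_))

extend : (Fin p → Bool) → Table p → Table (suc p)
extend bs T zero    zero    = true
extend bs T zero    (suc j) = bs j
extend bs T (suc i) zero    = not (bs i)
extend bs T (suc i) (suc j) = T i j

tournament : (Fin p → Fin n) → (Table p → Alg n) → Alg n
tournament {p = zero}  h k = k (λ ())
tournament {p = suc p} h k =
  compareWith (h zero) (h ∘ suc) λ bs → tournament (h ∘ suc) (k ∘ extend bs)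

pairs : ℕ → ℕ
pairs zero    = 0
pairs (suc p) = pairs p + p

pairs-≤ : q ≤ g → {w : ℕ} → 2 + q ≤ 2 * w → pairs (suc q) ≤ g * w
pairs-≤ {q} {g} q≤g {w} 2+q≤2w = *-cancelˡ-≤ 2 (begin
  2 * pairs (suc q)   ≡⟨ double-pairs q ⟩
  suc q * q           ≤⟨ *-mono-≤ (n≤1+n (suc q)) q≤g ⟩
  (2 + q) * g         ≤⟨ *-monoˡ-≤ g 2+q≤2w ⟩
  2 * w * g           ≡⟨ solve 2 (λ x y → con 2 :* x :* y := con 2 :* (y :* x)) refl w g ⟩
  2 * (g * w)         ∎)
  where
  open ≤-Reasoning
  double-pairs : ∀ q → 2 * pairs (suc q) ≡ suc q * q
  double-pairs zero    = refl
  double-pairs (suc q) = begin-equality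
    2 * (pairs (suc q) + suc q)       ≡⟨ *-distribˡ-+ 2 (pairs (suc q)) (suc q) ⟩
    2 * pairs (suc q) + 2 * suc q     ≡⟨ cong (_+ 2 * suc q) (double-pairs q) ⟩
    suc q * q + 2 * suc q
      ≡⟨ solve 1 (λ x → (con 1 :+ x) :* x :+ con 2 :* (con 1 :+ x) := (con 2 :+ x) :* (con 1 :+ x)) refl q ⟩
    suc (suc q) * suc q               ∎

extend-total : (bs : Fin p → Bool) (T : Table p) → Total (Wins T) → Total (Wins (extend bs T))
extend-total bs T total zero    zero    = inj₁ refl
extend-total bs T total zero    (suc j) with bs j
... | true  = inj₁ refl
... | false = inj₂ refl
extend-total bs T total (suc i) zero    with bs i
... | true  = inj₂ refl
... | false = inj₁ refl
extend-total bs T total (suc i) (suc j) = total i j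

p≤p+1 : (x : ℚ) → x ≤ℚ x +ℚ 1ℚ
p≤p+1 x = ℚ.≤-trans (ℚ.≤-reflexive (sym (ℚ.+-identityʳ x))) (ℚ.+-monoʳ-≤ x (ℚ.nonNegative⁻¹ 1ℚ))

Sound : (Fin n → ℚ) → (Fin p → Fin n) → Table p → Set
Sound val h T = ∀ i j → Wins T i j → val (h j) ≤ℚ val (h i) +ℚ 1ℚ

extend-sound : (val : Fin n → ℚ) (h : Fin (suc p) → Fin n) (bs : Fin p → Bool) (T : Table p) →
  (∀ j → Admissible val (h zero) (h (suc j)) (bs j)) → Sound val (h ∘ suc) T →
  Sound val h (extend bs T)
extend-sound val h bs T adm sound zero    zero    _ = p≤p+1 (val (h zero))
extend-sound val h bs T adm sound zero    (suc j) _ with bs j | adm j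
... | true  | a = a
extend-sound val h bs T adm sound (suc i) zero    _ with bs i | adm i
... | false | a = a
extend-sound val h bs T adm sound (suc i) (suc j) wins = sound i j wins

module _ {n : ℕ} (val : Fin n → ℚ) (B Z : ℕ → Set) where

  compareWith-good : (x : Fin n) (h : Fin q → Fin n) (k : (Fin q → Bool) → Alg n) (c : ℕ) →
    (∀ bs → (∀ j → Admissible val x (h j) (bs j)) → Good val B Z (q + c) (k bs)) →
    Good val B Z c (compareWith x h k)
  compareWith-good {q = zero}  x h k c good = good Vector.[] λ ()
  compareWith-good {q = suc q} x h k c good b adm =
    compareWith-good x (h ∘ suc) (k ∘ (b Vector.∷_)) (suc c) λ bs adms →
      subst (λ c′ → Good val B Z c′ (k (b Vector.∷ bs))) (sym (+-suc q c))
        (good (b Vector.∷ bs) λ { zero → adm ; (suc j) → adms j })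

  tournament-good : (h : Fin p → Fin n) (k : Table p → Alg n) (c : ℕ) →
    (∀ T → Sound val h T → Total (Wins T) → Good val B Z (pairs p + c) (k T)) →
    Good val B Z c (tournament h k)
  tournament-good {p = zero}  h k c good = good (λ ()) (λ ()) (λ ())
  tournament-good {p = suc p} h k c good =
    compareWith-good (h zero) (h ∘ suc) _ c λ bs adm →
      tournament-good (h ∘ suc) _ (p + c) λ T sound total →
        subst (λ c′ → Good val B Z c′ (k (extend bs T))) (+-assoc (pairs p) p c)
          (good (extend bs T) (extend-sound val h bs T adm sound) (extend-total bs T total))

keep : (Fin p → Bool) → (Fin p → A) → List A
keep {p = zero}  b h = []
keep {p = suc p} b h with b zero
... | true  = h zero ∷ keep (b ∘ suc) (h ∘ suc)
... | false = keep (b ∘ suc) (h ∘ suc)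

length-keep : (b : Fin p → Bool) (h : Fin p → A) → length (keep b h) ≡ count b
length-keep {p = zero}  b h = refl
length-keep {p = suc p} b h with b zero
... | true  = cong suc (length-keep (b ∘ suc) (h ∘ suc))
... | false = length-keep (b ∘ suc) (h ∘ suc)

keep-∈ : (b : Fin p → Bool) (h : Fin p → A) (i : Fin p) → b i ≡ true → h i ∈ keep b h
keep-∈ {p = suc p} b h zero    bi with b zero
keep-∈ {p = suc p} b h zero    refl | true = here refl
keep-∈ {p = suc p} b h (suc i) bi with b zero
... | true  = there (keep-∈ (b ∘ suc) (h ∘ suc) i bi)
... | false = keep-∈ (b ∘ suc) (h ∘ suc) i bi

≡true⊎∈-keep-not : (b : Fin p → Bool) (h : Fin p → A) (i : Fin p) → b i ≡ true ⊎ h i ∈ keep (not ∘ b) h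
≡true⊎∈-keep-not b h i with b i in bi
... | true  = inj₁ refl
... | false = inj₂ (keep-∈ (not ∘ b) h i (cong not bi))

-- A round on m undecided elements plays a group of 1 + g ⊓ (m - 1) of them, and at most
-- ⌊(g ⊓ (m - 1))/2⌋ of those are not beaten by the champion; the other m - 1 - g wait.
remaining : ℕ → ℕ → ℕ
remaining g zero    = 0
remaining g (suc m) = ⌊ g ⊓ m /2⌋ + (m ∸ g)

Clears : ℕ → ℕ → ℕ → Set
Clears g t m = iterate (remaining g) m t ≡ 0

iterate-mono : {f : ℕ → ℕ} → (∀ {a b} → a ≤ b → f a ≤ f b) →
  ∀ t {a b} → a ≤ b → iterate f a t ≤ iterate f b t
iterate-mono mono zero    a≤b = a≤b
iterate-mono mono (suc t) a≤b = iterate-mono mono t (mono a≤b)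

remaining-mono : ∀ g {m m′} → m ≤ m′ → remaining g m ≤ remaining g m′
remaining-mono g {zero}            _          = z≤n
remaining-mono g {suc m} {suc m′} (s≤s m≤m′) =
  +-mono-≤ (⌊n/2⌋-mono (⊓-monoʳ-≤ g m≤m′)) (∸-monoˡ-≤ g m≤m′)

Clears-antitone : ∀ t {m m′} → m ≤ m′ → Clears g t m′ → Clears g t m
Clears-antitone t m≤m′ clears =
  n≤0⇒n≡0 (subst (_ ≤_) clears (iterate-mono (remaining-mono _) t m≤m′))

Covered : (Fin n → ℚ) → List (Fin n) → List (Fin n) → Set
Covered {n} val U S = ∀ x → x ∈ U ⊎ ∃[ y ] (y ∈ S × val x ≤ℚ val y +ℚ 1ℚ)

covered-max-set : (val : Fin n → ℚ) {S : List (Fin n)} → Fin n → Covered val [] S → IsKMaxSet val 1ℚ S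
covered-max-set {n} val {S} x₀ covered with covered x₀
... | inj₂ (y₀ , y₀∈S , _) = best , best∈S , λ x → below-best (covered x)
  where
  module Q = Data.List.Extrema (DecTotalOrder.totalOrder ℚ.≤-decTotalOrder)
  best : Fin n
  best = Q.argmax val y₀ S
  best∈S : best ∈ S
  best∈S = [ (λ best≡y₀ → subst (_∈ S) (sym best≡y₀) y₀∈S) , id ]′ (Q.argmax-sel val y₀ S)
  below-best : ∀ {x} → x ∈ [] ⊎ ∃[ y ] (y ∈ S × val x ≤ℚ val y +ℚ 1ℚ) → val x ≤ℚ val best +ℚ 1ℚ
  below-best (inj₂ (y , y∈S , x≤y+1)) =
    ℚ.≤-trans x≤y+1 (ℚ.+-monoˡ-≤ 1ℚ (All.lookup (Q.f[xs]≤f[argmax] {f = val} y₀ S) y∈S))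

module Round {n : ℕ} (g : ℕ) (u : Fin n) (U : List (Fin n)) where

  group : List (Fin n)
  group = u ∷ take g U

  winner : Table (length group) → Fin n
  winner T = lookup group (champion T)

  survivors : Table (length group) → List (Fin n)
  survivors T = keep (not ∘ T (champion T)) (lookup group) ++ drop g U

  length-survivors : (T : Table (length group)) →
    length (survivors T) ≡ count (not ∘ T (champion T)) + (length U ∸ g)
  length-survivors T = begin
    length (survivors T)
      ≡⟨ length-++ (keep (not ∘ T (champion T)) (lookup group)) ⟩
    length (keep (not ∘ T (champion T)) (lookup group)) + length (drop g U)
      ≡⟨ cong₂ _+_ (length-keep (not ∘ T (champion T)) (lookup group)) (length-drop g U) ⟩
    count (not ∘ T (champion T)) + (length U ∸ g)  ∎
    where open ≡-Reasoning

  survivors-≤-remaining : (T : Table (length group)) → Total (Wins T) →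
    length (survivors T) ≤ remaining g (length (u ∷ U))
  survivors-≤-remaining T total = begin
    length (survivors T)
      ≡⟨ length-survivors T ⟩
    count (not ∘ T (champion T)) + (length U ∸ g)
      ≤⟨ +-monoˡ-≤ (length U ∸ g) (unbeaten-by-champion T total) ⟩
    ⌊ length (take g U) /2⌋ + (length U ∸ g)
      ≡⟨ cong (λ m → ⌊ m /2⌋ + (length U ∸ g)) (length-take g U) ⟩
    remaining g (length (u ∷ U))  ∎
    where open ≤-Reasoning

  round-cost : (T : Table (length group)) → Total (Wins T) →
    pairs (length group) + g * length (survivors T) ≤ g * length (u ∷ U)
  round-cost T total = begin
    pairs (length group) + g * length (survivors T)  ≤⟨ +-monoˡ-≤ _ (pairs-≤ group-≤ (champion-wins T total)) ⟩
    g * w + g * length (survivors T)                 ≡⟨ sym (*-distribˡ-+ g w _) ⟩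
    g * (w + length (survivors T))                   ≡⟨ cong (g *_) partition ⟩
    g * length (u ∷ U)                               ∎
    where
    open ≤-Reasoning
    w = count (T (champion T))
    r = count (not ∘ T (champion T))
    group-≤ : length (take g U) ≤ g
    group-≤ = ≤-trans (≤-reflexive (length-take g U)) (m⊓n≤m g (length U))
    partition : w + length (survivors T) ≡ length (u ∷ U)
    partition = begin-equality
      w + length (survivors T)                  ≡⟨ cong (w +_) (length-survivors T) ⟩
      w + (r + (length U ∸ g))                  ≡⟨ sym (+-assoc w r _) ⟩
      (w + r) + (length U ∸ g)
        ≡⟨ cong (_+ (length U ∸ g)) (trans (+-comm w r) (count-not (T (champion T)))) ⟩
      suc (length (take g U)) + (length U ∸ g)  ≡⟨ cong (λ m → suc m + (length U ∸ g)) (length-take g U) ⟩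
      suc (g ⊓ length U + (length U ∸ g))       ≡⟨ cong suc (m⊓n+n∸m≡n g (length U)) ⟩
      length (u ∷ U)                            ∎

  ∈-group-or-rest : ∀ {x} → x ∈ u ∷ U → x ∈ group ⊎ x ∈ drop g U
  ∈-group-or-rest (here refl) = inj₁ (here refl)
  ∈-group-or-rest (there x∈U) with ∈-++⁻ (take g U) (subst (_ ∈_) (sym (take++drop≡id g U)) x∈U)
  ... | inj₁ x∈take = inj₁ (there x∈take)
  ... | inj₂ x∈drop = inj₂ x∈drop

  module _ (val : Fin n → ℚ) (T : Table (length group)) (S : List (Fin n))
           (sound : Sound val (lookup group) T) where

    group-covered : ∀ i → lookup group i ∈ survivors T ⊎
      ∃[ y ] (y ∈ winner T ∷ S × val (lookup group i) ≤ℚ val y +ℚ 1ℚ)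
    group-covered i =
      [ (λ beaten → inj₂ (winner T , here refl , sound (champion T) i beaten))
      , (λ survivor → inj₁ (∈-++⁺ˡ survivor))
      ]′ (≡true⊎∈-keep-not (T (champion T)) (lookup group) i)

    survivors-covered : Covered val (u ∷ U) S → Covered val (survivors T) (winner T ∷ S)
    survivors-covered covered x with covered x
    ... | inj₂ (y , y∈S , x≤y+1) = inj₂ (y , there y∈S , x≤y+1)
    ... | inj₁ x∈uU with ∈-group-or-rest x∈uU
    ...   | inj₂ x∈rest = inj₁ (∈-++⁺ʳ _ x∈rest)
    ...   | inj₁ x∈group with index x∈group | lookup-index x∈group
    ...     | i | refl = group-covered i

oneCover : ℕ → ℕ → List (Fin n) → List (Fin n) → Alg n
oneCover g zero    U       S = done S
oneCover g (suc t) []      S = done S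
oneCover g (suc t) (u ∷ U) S =
  tournament (lookup group) λ T → oneCover g t (survivors T) (winner T ∷ S)
  where open Round g u U

module _ {n : ℕ} (val : Fin n → ℚ) {B Z : ℕ → Set} (g : ℕ) {K R : ℕ}
         (B-ok : ∀ {c} → c ≤ K → B c) (Z-ok : ∀ {m} → m ≤ R → Z m) (x₀ : Fin n) where

  done-good : ∀ {c S} → c ≤ K → length S ≤ R → Covered val [] S → Good val B Z c (done S)
  done-good c≤K S≤R covered = B-ok c≤K , Z-ok S≤R , covered-max-set val x₀ covered

  oneCover-good : ∀ t U S c → Clears g t (length U) → c + g * length U ≤ K → length S + t ≤ R →
    Covered val U S → Good val B Z c (oneCover g t U S)
  oneCover-good zero    []      S c _ cost size covered =
    done-good (≤-trans (m≤m+n c (g * 0)) cost) (≤-trans (m≤m+n (length S) 0) size) covered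
  oneCover-good zero    (u ∷ U) S c () cost size covered
  oneCover-good (suc t) []      S c _ cost size covered =
    done-good (≤-trans (m≤m+n c (g * 0)) cost) (≤-trans (m≤m+n (length S) (suc t)) size) covered
  oneCover-good (suc t) (u ∷ U) S c clears cost size covered =
    tournament-good val B Z (lookup group) _ c λ T sound total →
      oneCover-good t (survivors T) (winner T ∷ S) (pairs (length group) + c)
        (Clears-antitone t (survivors-≤-remaining T total) clears)
        (round-within-budget T total)
        (subst (_≤ R) (+-suc (length S) t) size)
        (survivors-covered val T S sound covered)
    where
    open Round g u U
    round-within-budget : ∀ T → Total (Wins T) →
      (pairs (length group) + c) + g * length (survivors T) ≤ K
    round-within-budget T total = begin
      (pairs (length group) + c) + g * length (survivors T)
        ≡⟨ solve 3 (λ a b d → (a :+ b) :+ d := b :+ (a :+ d)) refl (pairs (length group)) c _ ⟩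
      c + (pairs (length group) + g * length (survivors T))
        ≤⟨ +-monoʳ-≤ c (round-cost T total) ⟩
      c + g * length (u ∷ U)
        ≤⟨ cost ⟩
      K  ∎
      where open ≤-Reasoning

remaining-≤ : ∀ g m → remaining g m ≤ m
remaining-≤ g zero    = z≤n
remaining-≤ g (suc m) = m≤n⇒m≤1+n (begin
  ⌊ g ⊓ m /2⌋ + (m ∸ g)   ≤⟨ +-monoˡ-≤ (m ∸ g) (⌊n/2⌋≤n (g ⊓ m)) ⟩
  g ⊓ m + (m ∸ g)         ≡⟨ m⊓n+n∸m≡n g m ⟩
  m                       ∎)
  where open ≤-Reasoning

remaining-full : ∀ {g m} → g ≤ m → remaining g (suc m) + suc ⌈ g /2⌉ ≡ suc m
remaining-full {g} {m} g≤m = begin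
  ⌊ g ⊓ m /2⌋ + (m ∸ g) + suc ⌈ g /2⌉
    ≡⟨ cong (λ x → ⌊ x /2⌋ + (m ∸ g) + suc ⌈ g /2⌉) (m≤n⇒m⊓n≡m g≤m) ⟩
  ⌊ g /2⌋ + (m ∸ g) + suc ⌈ g /2⌉
    ≡⟨ solve 3 (λ a b c → a :+ b :+ (con 1 :+ c) := con 1 :+ ((a :+ c) :+ b)) refl ⌊ g /2⌋ (m ∸ g) ⌈ g /2⌉ ⟩
  suc (⌊ g /2⌋ + ⌈ g /2⌉ + (m ∸ g))
    ≡⟨ cong (λ x → suc (x + (m ∸ g))) (⌊n/2⌋+⌈n/2⌉≡n g) ⟩
  suc (g + (m ∸ g))
    ≡⟨ cong suc (m+[n∸m]≡n g≤m) ⟩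
  suc m  ∎
  where open ≡-Reasoning

remaining-tail : ∀ {g m} → m ≤ g → remaining g (suc m) ≡ ⌊ m /2⌋
remaining-tail {g} {m} m≤g rewrite m≥n⇒m⊓n≡n m≤g | m≤n⇒m∸n≡0 m≤g = +-identityʳ ⌊ m /2⌋

iterate-+ : (f : A → A) (x : A) (m n : ℕ) → iterate f x (m + n) ≡ iterate f (iterate f x m) n
iterate-+ f x zero    n = refl
iterate-+ f x (suc m) n = iterate-+ f (f x) m n

iterate-full : ∀ j {m} → m ≤ suc g + j * suc ⌈ g /2⌉ → iterate (remaining g) m j ≤ suc g
iterate-full {g} zero    m≤ = ≤-trans m≤ (≤-reflexive (+-identityʳ (suc g)))
iterate-full {g} (suc j) m≤ = iterate-full j (one-round _ m≤)
  where
  k = suc ⌈ g /2⌉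
  one-round : ∀ m → m ≤ suc g + (k + j * k) → remaining g m ≤ suc g + j * k
  one-round zero    _  = z≤n
  one-round (suc m) m≤ with m ≤? g
  ... | yes m≤g = ≤-trans (remaining-≤ g (suc m)) (≤-trans (s≤s m≤g) (m≤m+n (suc g) (j * k)))
  ... | no  m≰g = +-cancelʳ-≤ k _ _ (begin
    remaining g (suc m) + k   ≡⟨ remaining-full (<⇒≤ (≰⇒> m≰g)) ⟩
    suc m                     ≤⟨ m≤ ⟩
    suc g + (k + j * k)       ≡⟨ solve 3 (λ a b c → a :+ (b :+ c) := (a :+ c) :+ b) refl (suc g) k (j * k) ⟩
    suc g + j * k + k         ∎)
    where open ≤-Reasoning

m<2*n⇒⌊m/2⌋<n : ∀ {m n} → m < 2 * n → ⌊ m /2⌋ < n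
m<2*n⇒⌊m/2⌋<n {m} {n} m<2n = *-cancelˡ-< 2 ⌊ m /2⌋ n (begin-strict
  2 * ⌊ m /2⌋              ≡⟨ solve 1 (λ a → con 2 :* a := a :+ a) refl ⌊ m /2⌋ ⟩
  ⌊ m /2⌋ + ⌊ m /2⌋        ≤⟨ +-monoʳ-≤ ⌊ m /2⌋ (⌊n/2⌋≤⌈n/2⌉ m) ⟩
  ⌊ m /2⌋ + ⌈ m /2⌉        ≡⟨ ⌊n/2⌋+⌈n/2⌉≡n m ⟩
  m                        <⟨ m<2n ⟩
  2 * n                    ∎)
  where open ≤-Reasoning

iterate-tail : ∀ t {m} → m ≤ suc g → m < 2 ^ t → iterate (remaining g) m t ≡ 0
iterate-tail zero    m≤ m<1 = n<1⇒n≡0 m<1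
iterate-tail (suc t) {zero}  _ _ = iterate-tail t z≤n (m^n>0 2 t)
iterate-tail (suc t) {suc m} (s≤s m≤g) m<2^t rewrite remaining-tail m≤g =
  iterate-tail t (≤-trans (⌊n/2⌋≤n m) (m≤n⇒m≤1+n m≤g)) (m<2*n⇒⌊m/2⌋<n (<-trans (n<1+n m) m<2^t))

9*t+7<2^t : ∀ {t} → 6 ≤′ t → 9 * t + 7 < 2 ^ t
9*t+7<2^t ≤′-refl = m≤m+n 62 2
9*t+7<2^t {suc t} (≤′-step 6≤′t) = begin-strict
  9 * suc t + 7            ≡⟨ solve 1 (λ x → con 9 :* (con 1 :+ x) :+ con 7 := con 9 :+ (con 9 :* x :+ con 7)) refl t ⟩
  9 + (9 * t + 7)          <⟨ +-mono-≤-< (≤-trans (m≤m+n 9 55) (^-monoʳ-≤ 2 (≤′⇒≤ 6≤′t))) (9*t+7<2^t 6≤′t) ⟩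
  2 ^ t + 2 ^ t            ≡⟨ solve 1 (λ x → x :+ x := con 2 :* x) refl (2 ^ t) ⟩
  2 ^ suc t                ∎
  where open ≤-Reasoning

n≤⌈n/2⌉+⌈n/2⌉ : ∀ n → n ≤ ⌈ n /2⌉ + ⌈ n /2⌉
n≤⌈n/2⌉+⌈n/2⌉ n = begin
  n                        ≡⟨ sym (⌊n/2⌋+⌈n/2⌉≡n n) ⟩
  ⌊ n /2⌋ + ⌈ n /2⌉        ≤⟨ +-monoˡ-≤ ⌈ n /2⌉ (⌊n/2⌋≤⌈n/2⌉ n) ⟩
  ⌈ n /2⌉ + ⌈ n /2⌉        ∎
  where open ≤-Reasoning

SquareClears : ℕ → Set
SquareClears s = Clears (3 * s) s (s * s + 2 * s)

SquareClears? : ∀ s → Dec (SquareClears s)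
SquareClears? s = iterate (remaining (3 * s)) (s * s + 2 * s) s ≟ 0

-- j = s - t full rounds bring s² + 2s elements down to 3s + 1, and since 3s + 1 < 2^t,
-- t halving rounds finish the job.
clears-large : ∀ {s t} → 6 ≤ t → 3 * t ≤ s → s ≤ 2 + 3 * t → SquareClears s
clears-large {s} {t} 6≤t 3t≤s s≤2+3t = begin-equality
  iterate f (s * s + 2 * s) s                ≡⟨ cong (iterate f _) (sym j+t≡s) ⟩
  iterate f (s * s + 2 * s) (j + t)          ≡⟨ iterate-+ f _ j t ⟩
  iterate f (iterate f (s * s + 2 * s) j) t  ≡⟨ iterate-tail t after-full-rounds
                                                  (≤-<-trans after-full-rounds last-rounds) ⟩
  0                                          ∎
  where
  open ≤-Reasoning
  f = remaining (3 * s)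
  j = s ∸ t
  k = suc ⌈ 3 * s /2⌉
  j+t≡s : j + t ≡ s
  j+t≡s = m∸n+n≡m (≤-trans (m≤n*m t 3) 3t≤s)
  2s≤3j : 2 * s ≤ 3 * j
  2s≤3j = +-cancelʳ-≤ (3 * t) (2 * s) (3 * j) (begin
    2 * s + 3 * t        ≤⟨ +-monoʳ-≤ (2 * s) 3t≤s ⟩
    2 * s + s            ≡⟨ solve 1 (λ x → con 2 :* x :+ x := con 3 :* x) refl s ⟩
    3 * s                ≡⟨ cong (3 *_) (sym j+t≡s) ⟩
    3 * (j + t)          ≡⟨ *-distribˡ-+ 3 j t ⟩
    3 * j + 3 * t        ∎)
  3s+2≤2k : 3 * s + 2 ≤ 2 * k
  3s+2≤2k = ≤-trans (+-monoˡ-≤ 2 (n≤⌈n/2⌉+⌈n/2⌉ (3 * s)))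
    (≤-reflexive (solve 1 (λ x → x :+ x :+ con 2 := con 2 :* (con 1 :+ x)) refl ⌈ 3 * s /2⌉))
  full-rounds : s * s + 2 * s ≤ suc (3 * s) + j * k
  full-rounds = *-cancelˡ-≤ 6 (begin
    6 * (s * s + 2 * s)                      ≤⟨ m≤m+n _ (10 * s + 6) ⟩
    6 * (s * s + 2 * s) + (10 * s + 6)
      ≡⟨ solve 1 (λ x → con 6 :* (x :* x :+ con 2 :* x) :+ (con 10 :* x :+ con 6)
                      := con 6 :* (con 1 :+ con 3 :* x) :+ con 2 :* x :* (con 3 :* x :+ con 2)) refl s ⟩
    6 * suc (3 * s) + 2 * s * (3 * s + 2)    ≤⟨ +-monoʳ-≤ (6 * suc (3 * s)) (*-mono-≤ 2s≤3j 3s+2≤2k) ⟩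
    6 * suc (3 * s) + 3 * j * (2 * k)
      ≡⟨ solve 3 (λ a b c → con 6 :* a :+ con 3 :* b :* (con 2 :* c) := con 6 :* (a :+ b :* c))
           refl (suc (3 * s)) j k ⟩
    6 * (suc (3 * s) + j * k)                ∎)
  after-full-rounds : iterate f (s * s + 2 * s) j ≤ suc (3 * s)
  after-full-rounds = iterate-full j full-rounds
  last-rounds : suc (3 * s) < 2 ^ t
  last-rounds = ≤-<-trans (begin
    suc (3 * s)           ≤⟨ s≤s (*-monoʳ-≤ 3 s≤2+3t) ⟩
    suc (3 * (2 + 3 * t)) ≡⟨ solve 1 (λ x → con 1 :+ con 3 :* (con 2 :+ con 3 :* x) := con 9 :* x :+ con 7) refl t ⟩
    9 * t + 7             ∎) (9*t+7<2^t (≤⇒≤′ 6≤t))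

-- Tight at s = 9, where all nine rounds are needed.
clears-small : (i : Fin 9) → SquareClears (9 + toℕ i)
clears-small = from-yes (all? {n = 9} (SquareClears? ∘ (9 +_) ∘ toℕ))

clears-square : ∀ {s} → 9 ≤ s → SquareClears s
clears-square {s} 9≤s with s <? 18
... | yes s<18 = subst SquareClears (m+[n∸m]≡n 9≤s)
                   (subst (SquareClears ∘ (9 +_)) (toℕ-fromℕ< d<9) (clears-small (fromℕ< d<9)))
  where
  d<9 : s ∸ 9 < 9
  d<9 = +-cancelˡ-< 9 (s ∸ 9) 9 (subst (_< 18) (sym (m+[n∸m]≡n 9≤s)) s<18)
... | no s≮18 = clears-large (/-monoˡ-≤ 3 (≮⇒≥ s≮18)) 3[s/3]≤s s≤2+3[s/3]
  where
  3[s/3]≤s : 3 * (s / 3) ≤ s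
  3[s/3]≤s = ≤-trans (≤-reflexive (*-comm 3 (s / 3))) (m/n*n≤m s 3)
  s≤2+3[s/3] : s ≤ 2 + 3 * (s / 3)
  s≤2+3[s/3] = begin
    s                        ≡⟨ m≡m%n+[m/n]*n s 3 ⟩
    s % 3 + (s / 3) * 3      ≤⟨ +-mono-≤ (≤-pred (m%n<n s 3)) (≤-reflexive (*-comm (s / 3) 3)) ⟩
    2 + 3 * (s / 3)          ∎
    where open ≤-Reasoning

clears : ∀ {n s} → 81 ≤ n → n < suc s * suc s → Clears (3 * s) s n
clears {n} {s} 81≤n n<[1+s]² = Clears-antitone s n≤s²+2s (clears-square 9≤s)
  where
  9≤s : 9 ≤ s
  9≤s = ≮⇒≥ λ s<9 → <-irrefl refl (<-≤-trans n<[1+s]² (≤-trans (*-mono-≤ s<9 s<9) 81≤n))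
  n≤s²+2s : n ≤ s * s + 2 * s
  n≤s²+2s = ≤-trans (≤-pred n<[1+s]²)
    (≤-reflexive (solve 1 (λ x → x :+ x :* (con 1 :+ x) := x :* x :+ con 2 :* x) refl s))

integerSqrt : ∀ n → ∃[ s ] (s * s ≤ n × n < suc s * suc s)
integerSqrt zero = 0 , z≤n , s≤s z≤n
integerSqrt (suc n) with integerSqrt n
... | s , s²≤n , n<[1+s]² with suc s * suc s ≤? suc n
...   | yes [1+s]²≤1+n =
  suc s , [1+s]²≤1+n , ≤-<-trans n<[1+s]² (*-mono-< (n<1+n (suc s)) (n<1+n (suc s)))
...   | no  [1+s]²≰1+n = s , m≤n⇒m≤1+n s²≤n , ≰⇒> [1+s]²≰1+n

comparisons-bound : ∀ {n s c} → s * s ≤ n → c ≤ 3 * s * n → c * c ≤ 9 * n ^ 3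
comparisons-bound {n} {s} {c} s²≤n c≤3sn = begin
  c * c                          ≤⟨ *-mono-≤ c≤3sn c≤3sn ⟩
  (3 * s * n) * (3 * s * n)
    ≡⟨ solve 2 (λ a b → (con 3 :* a :* b) :* (con 3 :* a :* b) := con 9 :* (a :* a) :* (b :* b)) refl s n ⟩
  9 * (s * s) * (n * n)          ≤⟨ *-monoˡ-≤ (n * n) (*-monoʳ-≤ 9 s²≤n) ⟩
  9 * n * (n * n)                ≡⟨ solve 1 (λ a → con 9 :* a :* (a :* a) := con 9 :* (a :^ 3)) refl n ⟩
  9 * n ^ 3                      ∎
  where open ≤-Reasoning

lemma5 : (n : ℕ) → 81 ≤ n →
    Σ (Alg n) (λ A → (val : Fin n → ℚ) →
    Good val (WithinComparisons n) (WithinSqrt n) 0 A)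
lemma5 n 81≤n with integerSqrt n
... | s , s²≤n , n<[1+s]² = oneCover (3 * s) s (allFin n) [] , λ val →
  oneCover-good val (3 * s) (comparisons-bound {s = s} s²≤n) (λ m≤s → ≤-trans (*-mono-≤ m≤s m≤s) s²≤n) x₀
    s (allFin n) [] 0
    (subst (Clears (3 * s) s) (sym |allFin|) (clears {s = s} 81≤n n<[1+s]²))
    (≤-reflexive (cong (3 * s *_) |allFin|))
    ≤-refl
    (λ x → inj₁ (∈-allFin x))
  where
  |allFin| : length (allFin n) ≡ n
  |allFin| = length-tabulate id
  x₀ : Fin n
  x₀ = fromℕ< (≤-trans (s≤s z≤n) 81≤n)
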